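{- Let $\mathbb{K}=(G,M,I)$ be a context and $\mathbb{KC}_{SD}=((G,E_1),(M,E_2),I)$ the associated Kripke context. Then: (1) the lower and upper approximations of every semiconcept of $\mathbb{K}$ are definable semiconcepts of $\mathbb{KC}_{SD}$; (2) if $(A,B)$ is a definable semiconcept of $\mathbb{KC}_{SD}$, then $\underline{(A,B)}=(A,B)$ and $\overline{(A,B)}=(A,B)$; (3) for every semiconcept $(A,B)$ of $\mathbb{K}$, $\underline{(\underline{(A,B)})}=\underline{(A,B)}$ and $\overline{(\overline{(A,B)})}=\overline{(A,B)}$; (4) a left semiconcept $(A,B)$ of $\mathbb{K}$ is definable if and only if $A$ is a category of $(G,E_1)$; (5) a right semiconcept $(A,B)$ of $\mathbb{K}$ is definable if and only if $B$ is a category of $(M,E_2)$.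
   Context: A context is $\mathbb{K}=(G,M,I)$ with $I\subseteq G\times M$. For $A\subseteq G$, $A'=\{m\in M:gIm\ \forall g\in A\}$; for $B\subseteq M$, $B'=\{g\in G:gIm\ \forall m\in B\}$. A semiconcept is a pair $(A,B)$ with $A'=B$ or $B'=A$; a concept is a pair with $A'=B$ and $B'=A$; $\mathfrak{H}(\mathbb{K})$ and $\mathcal{B}(\mathbb{K})$ denote the sets of semiconcepts and concepts. A semiconcept is a left semiconcept if it is of the form $(A,A')$ and a right semiconcept if of the form $(B',B)$; $\mathfrak{H}(\mathbb{K})_\sqcap$ and $\mathfrak{H}(\mathbb{K})_\sqcup$ denote the sets of left and right semiconcepts (every semiconcept is in one of them, and $\mathcal{B}(\mathbb{K})$ is their intersection). Define equivalence relations $E_1$ on $G$ by $g_1E_1g_2$ iff $I(g_1)=I(g_2)$, where $I(g)=\{m:gIm\}$, and $E_2$ on $M$ by $m_1E_2m_2$ iff $I^{ -1}(m_1)=I^{ -1}(m_2)$, where $I^{ -1}(m)=\{g:gIm\}$; $\mathbb{KC}_{SD}:=((G,E_1),(M,E_2),I)$. For a relation $E$ on $W$ and $X\subseteq W$, with $E(x)=\{y:xEy\}$: $\underline{X}_E=\{x:E(x)\subseteq X\}$ and $\overline{X}^E=\{x:E(x)\cap X\neq\emptyset\}$. For an equivalence relation $E$ on $W$, a category of $(W,E)$ is a union of equivalence classes. A definable semiconcept of $\mathbb{KC}_{SD}$ is a semiconcept $(A,B)$ of $\mathbb{K}$ with $A$ a category of $(G,E_1)$ and $B$ a category of $(M,E_2)$.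 Approximations of a semiconcept $(A,B)$: if $(A,B)\in\mathcal{B}(\mathbb{K})$, then $\underline{(A,B)}=\overline{(A,B)}=(A,B)$; if $(A,B)\in\mathfrak{H}(\mathbb{K})_\sqcap\setminus\mathcal{B}(\mathbb{K})$, then $\underline{(A,B)}=(\underline{A}_{E_1},(\underline{A}_{E_1})')$ and $\overline{(A,B)}=(\overline{A}^{E_1},(\overline{A}^{E_1})')$; if $(A,B)\in\mathfrak{H}(\mathbb{K})_\sqcup\setminus\mathcal{B}(\mathbb{K})$, then $\underline{(A,B)}=((\overline{B}^{E_2})',\overline{B}^{E_2})$ and $\overline{(A,B)}=((\underline{B}_{E_2})',\underline{B}_{E_2})$. -}

module Defs where

open import Level using (0ℓ)
open import Data.Product using (Σ; ∃; _×_; _,_; proj₁; proj₂)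
open import Data.Sum using (_⊎_)
open import Relation.Nullary using (¬_)
open import Relation.Unary using (Pred; _∈_; _≐_)

record Context : Set₁ where
  field
    G : Set
    M : Set
    I : G → M → Set

module _ (K : Context) where
  open Context K

  _′ᴳ : Pred G 0ℓ → Pred M 0ℓ
  (A ′ᴳ) m = ∀ g → A g → I g m

  _′ᴹ : Pred M 0ℓ → Pred G 0ℓ
  (B ′ᴹ) g = ∀ m → B m → I g m

  Pair : Set₁
  Pair = Pred G 0ℓ × Pred M 0ℓ

  _≋_ : Pair → Pair → Set
  (A , B) ≋ (C , D) = (A ≐ C) × (B ≐ D)

  IsLeft : Pair → Set
  IsLeft (A , B) = (A ′ᴳ) ≐ B

  IsRight : Pair → Set
  IsRight (A , B) = (B ′ᴹ) ≐ A

  IsSemiconcept : Pair → Set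
  IsSemiconcept p = IsLeft p ⊎ IsRight p

  IsConcept : Pair → Set
  IsConcept p = IsLeft p × IsRight p

  E₁ : G → G → Set
  E₁ g₁ g₂ = (λ m → I g₁ m) ≐ (λ m → I g₂ m)

  E₂ : M → M → Set
  E₂ m₁ m₂ = (λ g → I g m₁) ≐ (λ g → I g m₂)

module _ {W : Set} (E : W → W → Set) where

  lowerA : Pred W 0ℓ → Pred W 0ℓ
  lowerA X x = ∀ y → E x y → X y

  upperA : Pred W 0ℓ → Pred W 0ℓ
  upperA X x = ∃ λ y → E x y × X y

  IsCategory : Pred W 0ℓ → Set₁
  IsCategory X = Σ (Pred W 0ℓ) λ S → X ≐ (λ y → ∃ λ x → S x × E x y)

module _ (K : Context) where
  open Context K

  IsDefinable : Pair K → Set₁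
  IsDefinable (A , B) =
    IsSemiconcept K (A , B) × IsCategory (E₁ K) A × IsCategory (E₂ K) B

  IsLowerApprox : Pair K → Pair K → Set
  IsLowerApprox (A , B) q =
      (IsConcept K (A , B) × q ≋₀ (A , B))
    ⊎ ((IsLeft K (A , B) × ¬ IsConcept K (A , B))
         × q ≋₀ (lowerA (E₁ K) A , _′ᴳ K (lowerA (E₁ K) A)))
    ⊎ ((IsRight K (A , B) × ¬ IsConcept K (A , B))
         × q ≋₀ (_′ᴹ K (upperA (E₂ K) B) , upperA (E₂ K) B))
    where
    _≋₀_ = _≋_ K

  IsUpperApprox : Pair K → Pair K → Set
  IsUpperApprox (A , B) q =
      (IsConcept K (A , B) × q ≋₀ (A , B))
    ⊎ ((IsLeft K (A , B) × ¬ IsConcept K (A , B))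
         × q ≋₀ (upperA (E₁ K) A , _′ᴳ K (upperA (E₁ K) A)))
    ⊎ ((IsRight K (A , B) × ¬ IsConcept K (A , B))
         × q ≋₀ (_′ᴹ K (lowerA (E₂ K) B) , lowerA (E₂ K) B))
    where
    _≋₀_ = _≋_ K

-- A subset is a category of an equivalence relation E exactly when it is closed under E.
-- Lower and upper approximations are E-closed and fix every E-closed set, and a derivation
-- A′ is always E₂-closed (B′ always E₁-closed), since E₂-equivalent attributes have the
-- same extent. Hence a semiconcept is definable iff its "free" component is closed; every
-- approximation is definable; definable semiconcepts are fixed by both approximations, and
-- idempotence follows.
module Submission where

open import Defs
open import Data.Product using (_×_; _,_)
open import Data.Sum using (inj₁; inj₂)
open import Function.Bundles using (_⇔_; mk⇔)
open import Level using (0ℓ)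
open import Relation.Binary.Definitions using (_Respects_)
open import Relation.Binary.Structures using (IsEquivalence)
import Relation.Binary.Construct.On as On
open import Relation.Unary using (Pred; _≐_)
open import Relation.Unary.Properties using (≐-refl; ≐-sym; ≐-trans)
open import Relation.Unary.Relation.Binary.Equality using (≐-isEquivalence)

respects-resp-≐ : {W : Set} {E : W → W → Set} {X Y : Pred W 0ℓ} →
                  X ≐ Y → X Respects E → Y Respects E
respects-resp-≐ (X⊆Y , Y⊆X) X-resp x∼y Yx = X⊆Y (X-resp x∼y (Y⊆X Yx))

module RoughSets {W : Set} {E : W → W → Set} (isEquivalence : IsEquivalence E) where
  open IsEquivalence isEquivalence using (refl; sym; trans)

  respects⇒isCategory : {X : Pred W 0ℓ} → X Respects E → IsCategory E X
  respects⇒isCategory {X} X-resp =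
    X , (λ {y} Xy → y , Xy , refl) , λ { (x , Xx , x∼y) → X-resp x∼y Xx }

  isCategory⇒respects : {X : Pred W 0ℓ} → IsCategory E X → X Respects E
  isCategory⇒respects (S , X⊆⋃S , ⋃S⊆X) x∼y Xx with X⊆⋃S Xx
  ... | z , Sz , z∼x = ⋃S⊆X (z , Sz , trans z∼x x∼y)

  lowerA-respects : (X : Pred W 0ℓ) → lowerA E X Respects E
  lowerA-respects X x∼y lowX z y∼z = lowX z (trans x∼y y∼z)

  upperA-respects : (X : Pred W 0ℓ) → upperA E X Respects E
  upperA-respects X x∼y (z , x∼z , Xz) = z , trans (sym x∼y) x∼z , Xz

  lowerA-fixes-respecting : {X : Pred W 0ℓ} → X Respects E → lowerA E X ≐ X
  lowerA-fixes-respecting X-resp = (λ {x} lowX → lowX x refl) , λ Xx y x∼y → X-resp x∼y Xx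

  upperA-fixes-respecting : {X : Pred W 0ℓ} → X Respects E → upperA E X ≐ X
  upperA-fixes-respecting X-resp =
    (λ { (z , x∼z , Xz) → X-resp (sym x∼z) Xz }) , λ {x} Xx → x , refl , Xx

module _ (K : Context) where
  open Context K

  private
    _′ : Pred G 0ℓ → Pred M 0ℓ
    _′ = _′ᴳ K
    _‵ : Pred M 0ℓ → Pred G 0ℓ
    _‵ = _′ᴹ K
    _≋′_ : Pair K → Pair K → Set
    _≋′_ = _≋_ K

  E₁-isEquivalence : IsEquivalence (E₁ K)
  E₁-isEquivalence = On.isEquivalence I ≐-isEquivalence

  E₂-isEquivalence : IsEquivalence (E₂ K)
  E₂-isEquivalence = On.isEquivalence (λ m g → I g m) ≐-isEquivalence

  private
    module R₁ = RoughSets E₁-isEquivalence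
    module R₂ = RoughSets E₂-isEquivalence

  ′ᴳ-cong : {A C : Pred G 0ℓ} → A ≐ C → (A ′) ≐ (C ′)
  ′ᴳ-cong (A⊆C , C⊆A) = (λ A′m g Cg → A′m g (C⊆A Cg)) , (λ C′m g Ag → C′m g (A⊆C Ag))

  ′ᴹ-cong : {B D : Pred M 0ℓ} → B ≐ D → (B ‵) ≐ (D ‵)
  ′ᴹ-cong (B⊆D , D⊆B) = (λ B′g m Dm → B′g m (D⊆B Dm)) , (λ D′g m Bm → D′g m (B⊆D Bm))

  ′ᴳ-respects-E₂ : (A : Pred G 0ℓ) → (A ′) Respects E₂ K
  ′ᴳ-respects-E₂ A (m⊆n , _) A′m g Ag = m⊆n (A′m g Ag)

  ′ᴹ-respects-E₁ : (B : Pred M 0ℓ) → (B ‵) Respects E₁ K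
  ′ᴹ-respects-E₁ B (g⊆h , _) B′g m Bm = g⊆h (B′g m Bm)

  isSemiconcept-resp-≋ : {p q : Pair K} → q ≋′ p → IsSemiconcept K p → IsSemiconcept K q
  isSemiconcept-resp-≋ (C≐A , D≐B) (inj₁ A′≐B) =
    inj₁ (≐-trans (′ᴳ-cong C≐A) (≐-trans A′≐B (≐-sym D≐B)))
  isSemiconcept-resp-≋ (C≐A , D≐B) (inj₂ B′≐A) =
    inj₂ (≐-trans (′ᴹ-cong D≐B) (≐-trans B′≐A (≐-sym C≐A)))

  left-isDefinable : {X : Pred G 0ℓ} {q : Pair K} →
                     X Respects E₁ K → q ≋′ (X , X ′) → IsDefinable K q
  left-isDefinable {X} X-resp q≋@(C≐X , D≐X′) =
      isSemiconcept-resp-≋ q≋ (inj₁ ≐-refl)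
    , R₁.respects⇒isCategory (respects-resp-≐ (≐-sym C≐X) X-resp)
    , R₂.respects⇒isCategory (respects-resp-≐ (≐-sym D≐X′) (′ᴳ-respects-E₂ X))

  right-isDefinable : {Y : Pred M 0ℓ} {q : Pair K} →
                      Y Respects E₂ K → q ≋′ (Y ‵ , Y) → IsDefinable K q
  right-isDefinable {Y} Y-resp q≋@(C≐Y′ , D≐Y) =
      isSemiconcept-resp-≋ q≋ (inj₂ ≐-refl)
    , R₁.respects⇒isCategory (respects-resp-≐ (≐-sym C≐Y′) (′ᴹ-respects-E₁ Y))
    , R₂.respects⇒isCategory (respects-resp-≐ (≐-sym D≐Y) Y-resp)

  concept-isDefinable : {A : Pred G 0ℓ} {B : Pred M 0ℓ} {q : Pair K} →
                        IsConcept K (A , B) → q ≋′ (A , B) → IsDefinable K q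
  concept-isDefinable {B = B} (A′≐B , B′≐A) (C≐A , D≐B) =
    left-isDefinable (respects-resp-≐ B′≐A (′ᴹ-respects-E₁ B))
                     (C≐A , ≐-trans D≐B (≐-sym A′≐B))

  lowerApprox-isDefinable : (p q : Pair K) → IsLowerApprox K p q → IsDefinable K q
  lowerApprox-isDefinable p       q (inj₁ (concept , q≋p)) = concept-isDefinable concept q≋p
  lowerApprox-isDefinable (A , B) q (inj₂ (inj₁ (_ , q≋))) =
    left-isDefinable (R₁.lowerA-respects A) q≋
  lowerApprox-isDefinable (A , B) q (inj₂ (inj₂ (_ , q≋))) =
    right-isDefinable (R₂.upperA-respects B) q≋

  upperApprox-isDefinable : (p q : Pair K) → IsUpperApprox K p q → IsDefinable K q
  upperApprox-isDefinable p       q (inj₁ (concept , q≋p)) = concept-isDefinable concept q≋p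
  upperApprox-isDefinable (A , B) q (inj₂ (inj₁ (_ , q≋))) =
    left-isDefinable (R₁.upperA-respects A) q≋
  upperApprox-isDefinable (A , B) q (inj₂ (inj₂ (_ , q≋))) =
    right-isDefinable (R₂.lowerA-respects B) q≋

  left-≋ : {A X : Pred G 0ℓ} {B : Pred M 0ℓ} {q : Pair K} →
           IsLeft K (A , B) → X ≐ A → q ≋′ (X , X ′) → q ≋′ (A , B)
  left-≋ A′≐B X≐A (C≐X , D≐X′) =
    ≐-trans C≐X X≐A , ≐-trans D≐X′ (≐-trans (′ᴳ-cong X≐A) A′≐B)

  right-≋ : {A : Pred G 0ℓ} {B Y : Pred M 0ℓ} {q : Pair K} →
            IsRight K (A , B) → Y ≐ B → q ≋′ (Y ‵ , Y) → q ≋′ (A , B)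
  right-≋ B′≐A Y≐B (C≐Y′ , D≐Y) =
    ≐-trans C≐Y′ (≐-trans (′ᴹ-cong Y≐B) B′≐A) , ≐-trans D≐Y Y≐B

  isDefinable⇒lowerApprox-≋ : (p q : Pair K) → IsDefinable K p →
                              IsLowerApprox K p q → q ≋′ p
  isDefinable⇒lowerApprox-≋ p q _ (inj₁ (_ , q≋p)) = q≋p
  isDefinable⇒lowerApprox-≋ p q (_ , catA , _) (inj₂ (inj₁ ((left , _) , q≋))) =
    left-≋ left (R₁.lowerA-fixes-respecting (R₁.isCategory⇒respects catA)) q≋
  isDefinable⇒lowerApprox-≋ p q (_ , _ , catB) (inj₂ (inj₂ ((right , _) , q≋))) =
    right-≋ right (R₂.upperA-fixes-respecting (R₂.isCategory⇒respects catB)) q≋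

  isDefinable⇒upperApprox-≋ : (p q : Pair K) → IsDefinable K p →
                              IsUpperApprox K p q → q ≋′ p
  isDefinable⇒upperApprox-≋ p q _ (inj₁ (_ , q≋p)) = q≋p
  isDefinable⇒upperApprox-≋ p q (_ , catA , _) (inj₂ (inj₁ ((left , _) , q≋))) =
    left-≋ left (R₁.upperA-fixes-respecting (R₁.isCategory⇒respects catA)) q≋
  isDefinable⇒upperApprox-≋ p q (_ , _ , catB) (inj₂ (inj₂ ((right , _) , q≋))) =
    right-≋ right (R₂.lowerA-fixes-respecting (R₂.isCategory⇒respects catB)) q≋

  lowerApprox-idempotent : (p q r : Pair K) →
                           IsLowerApprox K p q → IsLowerApprox K q r → r ≋′ q
  lowerApprox-idempotent p q r p↓q = isDefinable⇒lowerApprox-≋ q r (lowerApprox-isDefinable p q p↓q)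

  upperApprox-idempotent : (p q r : Pair K) →
                           IsUpperApprox K p q → IsUpperApprox K q r → r ≋′ q
  upperApprox-idempotent p q r p↑q = isDefinable⇒upperApprox-≋ q r (upperApprox-isDefinable p q p↑q)

  left-isDefinable⇔isCategory : (A : Pred G 0ℓ) (B : Pred M 0ℓ) → IsLeft K (A , B) →
                                IsDefinable K (A , B) ⇔ IsCategory (E₁ K) A
  left-isDefinable⇔isCategory A B A′≐B = mk⇔ (λ (_ , catA , _) → catA)
    (λ catA → inj₁ A′≐B , catA ,
              R₂.respects⇒isCategory (respects-resp-≐ A′≐B (′ᴳ-respects-E₂ A)))

  right-isDefinable⇔isCategory : (A : Pred G 0ℓ) (B : Pred M 0ℓ) → IsRight K (A , B) →
                                 IsDefinable K (A , B) ⇔ IsCategory (E₂ K) B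
  right-isDefinable⇔isCategory A B B′≐A = mk⇔ (λ (_ , _ , catB) → catB)
    (λ catB → inj₂ B′≐A ,
              R₁.respects⇒isCategory (respects-resp-≐ B′≐A (′ᴹ-respects-E₁ B)) , catB)

corollary102 : (K : Context) →
    -- (1) approximations of semiconcepts are definable
    ((p : Pair K) → IsSemiconcept K p →
       ((q : Pair K) → IsLowerApprox K p q → IsDefinable K q)
       × ((q : Pair K) → IsUpperApprox K p q → IsDefinable K q))
    -- (2) definable semiconcepts are fixed by both approximations
    × ((p : Pair K) → IsDefinable K p →
       ((q : Pair K) → IsLowerApprox K p q → _≋_ K q p)
       × ((q : Pair K) → IsUpperApprox K p q → _≋_ K q p))
    -- (3) idempotence of the approximations
    × ((p : Pair K) → IsSemiconcept K p →
       ((q r : Pair K) → IsLowerApprox K p q → IsLowerApprox K q r → _≋_ K r q)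
       × ((q r : Pair K) → IsUpperApprox K p q → IsUpperApprox K q r → _≋_ K r q))
    -- (4) left semiconcepts: definable iff A is a category of (G, E₁)
    × ((A : _) (B : _) → IsLeft K (A , B) →
       IsDefinable K (A , B) ⇔ IsCategory (E₁ K) A)
    -- (5) right semiconcepts: definable iff B is a category of (M, E₂)
    × ((A : _) (B : _) → IsRight K (A , B) →
       IsDefinable K (A , B) ⇔ IsCategory (E₂ K) B)
corollary102 K =
    (λ p _ → lowerApprox-isDefinable K p , upperApprox-isDefinable K p)
  , (λ p p-def → (λ q → isDefinable⇒lowerApprox-≋ K p q p-def)
               , (λ q → isDefinable⇒upperApprox-≋ K p q p-def))
  , (λ p _ → lowerApprox-idempotent K p , upperApprox-idempotent K p)
  , left-isDefinable⇔isCategory K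
  , right-isDefinable⇔isCategory K
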